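{- Let $n$ and $d$ be positive integers with $\gcd(n,d)=1$, let $r$ be an integer with $\gcd(r,d)=1$, and let $m$ be the least nonnegative residue of $-r/d$ modulo $n$ (so $0\le m\le n-1$ and $md\equiv -r\pmod n$). For $k\in\{1,2,\ldots,m\}$, write $$ \frac{1-q^{md+r}}{1-q^{dk}}=\frac{A_k(q)}{B_k(q)}, $$ where $A_k(q)$ and $B_k(q)$ are relatively prime polynomials in $q$. Then $B_k(q)$ is relatively prime to $1-q^n$. -}

module Defs where

open import Data.Nat as ℕ using (ℕ; zero; suc)
open import Data.Integer as ℤ using (ℤ; +_; -[1+_])
open import Data.Rational as ℚ using (ℚ; 0ℚ; 1ℚ)
open import Data.List using (List; []; _∷_; replicate; _++_; map)
open import Data.Product using (∃; _×_)
open import Relation.Binary.PropositionalEquality using (_≡_)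
open import Relation.Nullary using (¬_)

-- Polynomials in q with rational coefficients, as coefficient lists
-- (constant term first). Trailing zeros are allowed; equality is
-- coefficientwise (_≈_).
Poly : Set
Poly = List ℚ

coeff : Poly → ℕ → ℚ
coeff []      _       = 0ℚ
coeff (a ∷ p) zero    = a
coeff (a ∷ p) (suc i) = coeff p i

infix 4 _≈_
_≈_ : Poly → Poly → Set
p ≈ s = ∀ i → coeff p i ≡ coeff s i

infixl 6 _⊕_ _⊖_
infixl 7 _⊛_

_⊕_ : Poly → Poly → Poly
[]      ⊕ s       = s
(a ∷ p) ⊕ []      = a ∷ p
(a ∷ p) ⊕ (b ∷ s) = (a ℚ.+ b) ∷ (p ⊕ s)

neg : Poly → Poly
neg = map (λ a → ℚ.- a)

_⊖_ : Poly → Poly → Poly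
p ⊖ s = p ⊕ neg s

scale : ℚ → Poly → Poly
scale c = map (c ℚ.*_)

_⊛_ : Poly → Poly → Poly
[]      ⊛ s = []
(a ∷ p) ⊛ s = scale a s ⊕ (0ℚ ∷ (p ⊛ s))

zeroP : Poly
zeroP = []

oneP : Poly
oneP = 1ℚ ∷ []

qPow : ℕ → Poly
qPow e = replicate e 0ℚ ++ (1ℚ ∷ [])

infix 4 _∣P_
_∣P_ : Poly → Poly → Set
c ∣P p = ∃ λ t → t ⊛ c ≈ p

RelPrime : Poly → Poly → Set
RelPrime a b = ∀ c → c ∣P a → c ∣P b → c ∣P oneP

-- For an integer exponent e, the rational function 1 - q^e written as
-- numer e / denom e with polynomials.
--   e = a ≥ 0 :  (1 - q^a) / 1
--   e = -(a+1):  1 - q^{-(a+1)} = (q^{a+1} - 1) / q^{a+1}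
numer : ℤ → Poly
numer (+ a)      = oneP ⊖ qPow a
numer -[1+ a ]   = qPow (suc a) ⊖ oneP

denom : ℤ → Poly
denom (+ a)      = oneP
denom -[1+ a ]   = qPow (suc a)

-- "(1 - q^e)/(1 - q^f) = A/B" as rational functions, with B ≠ 0:
-- A * denom e * (1 - q^f) = B * numer e.
RepQuot : ℤ → ℕ → Poly → Poly → Set
RepQuot e f A B = (¬ (B ≈ zeroP)) × (A ⊛ denom e ⊛ (oneP ⊖ qPow f) ≈ B ⊛ numer e)

{-# OPTIONS --safe #-}

-- Let c be a common divisor of B and 1 - qⁿ. Since n divides e = md + r, 1 - qⁿ divides the
-- numerator of 1 - qᵉ, so c² divides B·numer e = A·denom e·(1 - q^(dk)). In ℚ[q] the Euclidean
-- algorithm gives Bézout identities, so c is comaximal with A (as A and B are coprime), and it is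
-- comaximal with q (as c ∣ 1 - qⁿ) and hence with denom e, a power of q. Therefore c² divides
-- 1 - q^(dk). This polynomial is squarefree: c² ∣ f forces c ∣ f′ = -dk·q^(dk-1), and a
-- divisor of a power of q that is comaximal with q is a unit.

module Submission where

open import Algebra.Bundles using (CommutativeRing; AbelianGroup; RawGroup)
open import Data.Nat.Base using (ℕ; zero; suc)
open import Data.Product.Base using (∃; ∃₂; _×_; _,_)
import Relation.Binary.Reasoning.Setoid as ≈-Reasoning

module CommutativeRingDivisibility {c ℓ} (R : CommutativeRing c ℓ) where

  open CommutativeRing R
  open import Algebra.Properties.Semiring.Divisibility semiring public
    using (_∣_; _,_; _∣0; ∣ʳ-refl; ∣ʳ-trans; ∣ʳ-respˡ-≈; ∣ʳ-respʳ-≈; x∣ʳy⇒x∣ʳzy)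
  open import Algebra.Properties.CommutativeSemigroup.Divisibility *-commutativeSemigroup public
    using (∙-cong-∣)
  open import Algebra.Properties.Semiring.Exp semiring public using (_^_; ^-assocʳ)
  open import Algebra.Properties.Ring ring using (-‿distribˡ-*; x[y-z]≈xy-xz)
  open import Algebra.Properties.Group +-group using (//-rightDividesˡ)
  open import Algebra.Solver.Ring.NaturalCoefficients.Default commutativeSemiring
  open ≈-Reasoning setoid

  Comaximal : Carrier → Carrier → Set _
  Comaximal x y = ∃₂ λ u v → u * x + v * y ≈ 1#

  Coprime : Carrier → Carrier → Set _
  Coprime x y = ∀ g → g ∣ x → g ∣ y → g ∣ 1#

  Bézout : Carrier → Carrier → Set _
  Bézout x y = ∃ λ g → g ∣ x × g ∣ y × ∃₂ λ u v → u * x + v * y ≈ g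

  ∣-+ : ∀ {x y z} → x ∣ y → x ∣ z → x ∣ y + z
  ∣-+ {x} (p , px≈y) (q , qx≈z) = p + q , trans (distribʳ x p q) (+-cong px≈y qx≈z)

  ∣-‿ : ∀ {x y} → x ∣ y → x ∣ - y
  ∣-‿ {x} (p , px≈y) = - p , trans (sym (-‿distribˡ-* p x)) (-‿cong px≈y)

  1-x∣1-x^n : ∀ x n → 1# - x ∣ 1# - x ^ n
  1-x∣1-x^n x zero    = 0# , trans (zeroˡ (1# - x)) (sym (-‿inverseʳ 1#))
  1-x∣1-x^n x (suc n) = ∣ʳ-respʳ-≈ split (∣-+ ∣ʳ-refl (x∣ʳy⇒x∣ʳzy x (1-x∣1-x^n x n)))
    where
    split : 1# - x + x * (1# - x ^ n) ≈ 1# - x ^ suc n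
    split = begin
      1# - x + x * (1# - x ^ n)     ≈⟨ +-congˡ (x[y-z]≈xy-xz x 1# (x ^ n)) ⟩
      1# - x + (x * 1# - x ^ suc n) ≈⟨ +-congˡ (+-congʳ (*-identityʳ x)) ⟩
      1# - x + (x - x ^ suc n)      ≈⟨ +-assoc (1# - x) x (- x ^ suc n) ⟨
      1# - x + x - x ^ suc n        ≈⟨ +-congʳ (//-rightDividesˡ x 1#) ⟩
      1# - x ^ suc n                ∎

  comaximal-sym : ∀ {x y} → Comaximal x y → Comaximal y x
  comaximal-sym {x} {y} (u , v , eq) = v , u , trans (+-comm (v * y) (u * x)) eq

  comaximal-respʳ : ∀ {x y y′} → y ≈ y′ → Comaximal x y → Comaximal x y′
  comaximal-respʳ y≈y′ (u , v , eq) = u , v , trans (+-congˡ (*-congˡ (sym y≈y′))) eq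

  comaximal-*ʳ : ∀ {x y z} → Comaximal x y → Comaximal x z → Comaximal x (y * z)
  comaximal-*ʳ {x} {y} {z} (u , v , eq) (u′ , v′ , eq′) =
    u * u′ * x + u * v′ * z + v * y * u′ , v * v′ , (begin
      (u * u′ * x + u * v′ * z + v * y * u′) * x + v * v′ * (y * z) ≈⟨ expand u v u′ v′ x y z ⟩
      (u * x + v * y) * (u′ * x + v′ * z)                           ≈⟨ *-cong eq eq′ ⟩
      1# * 1#                                                       ≈⟨ *-identityˡ 1# ⟩
      1#                                                            ∎)
    where
    expand : ∀ u v u′ v′ x y z → (u * u′ * x + u * v′ * z + v * y * u′) * x + v * v′ * (y * z)
                                 ≈ (u * x + v * y) * (u′ * x + v′ * z)
    expand = solve 7 (λ u v u′ v′ x y z →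
      (u :* u′ :* x :+ u :* v′ :* z :+ v :* y :* u′) :* x :+ v :* v′ :* (y :* z) :=
      (u :* x :+ v :* y) :* (u′ :* x :+ v′ :* z)) refl

  comaximal-*ˡ : ∀ {x y z} → Comaximal x z → Comaximal y z → Comaximal (x * y) z
  comaximal-*ˡ x⊥z y⊥z = comaximal-sym (comaximal-*ʳ (comaximal-sym x⊥z) (comaximal-sym y⊥z))

  comaximal-^ʳ : ∀ {x y} → Comaximal x y → ∀ n → Comaximal x (y ^ n)
  comaximal-^ʳ {x} x⊥y zero    = 0# , 1# , trans (+-cong (zeroˡ x) (*-identityˡ 1#)) (+-identityˡ 1#)
  comaximal-^ʳ     x⊥y (suc n) = comaximal-*ʳ x⊥y (comaximal-^ʳ x⊥y n)

  x∣1-yz⇒comaximal : ∀ {x y z} → x ∣ 1# - y * z → Comaximal x y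
  x∣1-yz⇒comaximal {x} {y} {z} (t , tx≈1-yz) = t , z , (begin
    t * x + z * y      ≈⟨ +-cong tx≈1-yz (*-comm z y) ⟩
    1# - y * z + y * z ≈⟨ //-rightDividesˡ (y * z) 1# ⟩
    1#                 ∎)

  comaximal∧x∣yz⇒x∣z : ∀ {x y z} → Comaximal x y → x ∣ y * z → x ∣ z
  comaximal∧x∣yz⇒x∣z {x} {y} {z} (u , v , eq) (t , tx≈yz) = u * z + v * t , (begin
    (u * z + v * t) * x     ≈⟨ distribute u v x z t ⟩
    u * x * z + v * (t * x) ≈⟨ +-congˡ (*-congˡ tx≈yz) ⟩
    u * x * z + v * (y * z) ≈⟨ collect u v x y z ⟩
    (u * x + v * y) * z     ≈⟨ *-congʳ eq ⟩
    1# * z                  ≈⟨ *-identityˡ z ⟩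
    z                       ∎)
    where
    distribute : ∀ u v x z t → (u * z + v * t) * x ≈ u * x * z + v * (t * x)
    distribute = solve 5 (λ u v x z t → (u :* z :+ v :* t) :* x := u :* x :* z :+ v :* (t :* x)) refl
    collect : ∀ u v x y z → u * x * z + v * (y * z) ≈ (u * x + v * y) * z
    collect = solve 5 (λ u v x y z → u :* x :* z :+ v :* (y :* z) := (u :* x :+ v :* y) :* z) refl

  comaximal∧x∣y⇒x∣1 : ∀ {x y} → Comaximal x y → x ∣ y → x ∣ 1#
  comaximal∧x∣y⇒x∣1 {y = y} x⊥y x∣y = comaximal∧x∣yz⇒x∣z x⊥y (∣ʳ-respʳ-≈ (sym (*-identityʳ y)) x∣y)

  bézout-zero : ∀ {x y} → y ≈ 0# → Bézout x y
  bézout-zero {x} {y} y≈0 = x , ∣ʳ-refl , ∣ʳ-respʳ-≈ (sym y≈0) (x ∣0) , 1# , 0# , (begin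
    1# * x + 0# * y ≈⟨ +-cong (*-identityˡ x) (zeroˡ y) ⟩
    x + 0#          ≈⟨ +-identityʳ x ⟩
    x               ∎)

  bézout-step : ∀ {x y q r} → x ≈ q * y + r → Bézout y r → Bézout x y
  bézout-step {x} {y} {q} {r} x≈qy+r (g , g∣y , g∣r , u , v , uy+vr≈g) =
    g , ∣ʳ-respʳ-≈ (sym x≈qy+r) (∣-+ (x∣ʳy⇒x∣ʳzy q g∣y) g∣r) , g∣y , v , u - v * q , (begin
      v * x + (u - v * q) * y           ≈⟨ +-congʳ (*-congˡ x≈qy+r) ⟩
      v * (q * y + r) + (u - v * q) * y ≈⟨ regroup v q y r (u - v * q) ⟩
      (u - v * q + v * q) * y + v * r   ≈⟨ +-congʳ (*-congʳ (//-rightDividesˡ (v * q) u)) ⟩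
      u * y + v * r                     ≈⟨ uy+vr≈g ⟩
      g                                 ∎)
    where
    regroup : ∀ v q y r w → v * (q * y + r) + w * y ≈ (w + v * q) * y + v * r
    regroup = solve 5 (λ v q y r w → v :* (q :* y :+ r) :+ w :* y := (w :+ v :* q) :* y :+ v :* r) refl

  bézout∧coprime⇒comaximal : ∀ {x y} → Bézout x y → Coprime x y → Comaximal x y
  bézout∧coprime⇒comaximal {x} {y} (g , g∣x , g∣y , u , v , ux+vy≈g) x⊥y
    with t , tg≈1 ← x⊥y g g∣x g∣y = t * u , t * v , (begin
      t * u * x + t * v * y     ≈⟨ +-cong (*-assoc t u x) (*-assoc t v y) ⟩
      t * (u * x) + t * (v * y) ≈⟨ distribˡ t (u * x) (v * y) ⟨
      t * (u * x + v * y)       ≈⟨ *-congˡ ux+vy≈g ⟩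
      t * g                     ≈⟨ tg≈1 ⟩
      1#                        ∎)

open import Defs hiding (_≈_)
open import Data.Nat using (ℕ; _*_; _<_; _≤_)
open import Data.Nat.GCD using (gcd)
open import Data.Integer using (ℤ; +_; ∣_∣) renaming (_+_ to _+ℤ_)
open import Data.Integer.Divisibility using () renaming (_∣_ to _∣ℤ_)
open import Data.Product using (_×_)
open import Relation.Binary.PropositionalEquality using (_≡_)

import Data.Nat as ℕ
import Data.Nat.Properties as ℕ
open import Data.Nat.Divisibility.Core using (divides)
open import Data.Integer.Base using (-[1+_])
open import Data.List.Base using ([]; _∷_; length)
open import Data.Maybe.Base using (nothing)
open import Data.Rational as ℚ using (ℚ; 0ℚ; 1ℚ)
import Data.Rational.Properties as ℚ
open import Data.Sum.Base using (inj₁; inj₂)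
open import Function.Base using (_∘_)
open import Level using (0ℓ)
open import Relation.Binary.PropositionalEquality
  using (_≢_; refl; sym; trans; cong; cong₂; subst; module ≡-Reasoning)
open import Relation.Nullary.Decidable.Core using (yes; no)
open import Tactic.RingSolver using (solve-∀)
open import Tactic.RingSolver.Core.AlmostCommutativeRing using (AlmostCommutativeRing; fromCommutativeRing)

-- Defs._≈_ is a bare function type, from which Agda cannot recover the two polynomials;
-- the record makes them inferable.
infix 4 _≋_
record _≋_ (p s : Poly) : Set where
  constructor mk≋
  field coeff-≡ : Defs._≈_ p s
open _≋_

coeff-⊕ : ∀ p s i → coeff (p ⊕ s) i ≡ coeff p i ℚ.+ coeff s i
coeff-⊕ []      s       i       = sym (ℚ.+-identityˡ (coeff s i))
coeff-⊕ (a ∷ p) []      i       = sym (ℚ.+-identityʳ (coeff (a ∷ p) i))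
coeff-⊕ (a ∷ p) (b ∷ s) zero    = refl
coeff-⊕ (a ∷ p) (b ∷ s) (suc i) = coeff-⊕ p s i

coeff-neg : ∀ p i → coeff (neg p) i ≡ ℚ.- coeff p i
coeff-neg []      i       = refl
coeff-neg (a ∷ p) zero    = refl
coeff-neg (a ∷ p) (suc i) = coeff-neg p i

coeff-scale : ∀ a p i → coeff (scale a p) i ≡ a ℚ.* coeff p i
coeff-scale a []      i       = sym (ℚ.*-zeroʳ a)
coeff-scale a (b ∷ p) zero    = refl
coeff-scale a (b ∷ p) (suc i) = coeff-scale a p i

module _ where
  open import Algebra.Construct.Pointwise ℕ using (abelianGroup)
  open import Algebra.Morphism.Structures using (IsGroupMonomorphism)
  import Algebra.Morphism.GroupMonomorphism as GroupMonomorphism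

  ℚ^ℕ : AbelianGroup 0ℓ 0ℓ
  ℚ^ℕ = abelianGroup ℚ.+-0-abelianGroup

  ⊕-rawGroup : RawGroup 0ℓ 0ℓ
  ⊕-rawGroup = record { _≈_ = _≋_ ; _∙_ = _⊕_ ; ε = zeroP ; _⁻¹ = neg }

  coeff-isGroupMonomorphism : IsGroupMonomorphism ⊕-rawGroup (AbelianGroup.rawGroup ℚ^ℕ) coeff
  coeff-isGroupMonomorphism = record
    { isGroupHomomorphism = record
      { isMonoidHomomorphism = record
        { isMagmaHomomorphism = record
          { isRelHomomorphism = record { cong = coeff-≡ }
          ; homo              = coeff-⊕
          }
        ; ε-homo = λ _ → refl
        }
      ; ⁻¹-homo = coeff-neg
      }
    ; injective = mk≋
    }

  ⊕-abelianGroup : AbelianGroup 0ℓ 0ℓ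
  ⊕-abelianGroup = record
    { isAbelianGroup = GroupMonomorphism.isAbelianGroup coeff-isGroupMonomorphism
                         (AbelianGroup.isAbelianGroup ℚ^ℕ)
    }

open AbelianGroup ⊕-abelianGroup
  using (setoid)
  renaming ( refl to ≋-refl; sym to ≋-sym; trans to ≋-trans; reflexive to ≋-reflexive
           ; ∙-cong to ⊕-cong; ∙-congˡ to ⊕-congˡ; ∙-congʳ to ⊕-congʳ; identityʳ to ⊕-identityʳ)
open import Algebra.Properties.CommutativeSemigroup (AbelianGroup.commutativeSemigroup ⊕-abelianGroup)
  using (interchange; x∙yz≈y∙xz)

∷-cong : ∀ {a b p s} → a ≡ b → p ≋ s → a ∷ p ≋ b ∷ s
∷-cong refl (mk≋ p≈s) = mk≋ λ where
  zero    → refl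
  (suc i) → p≈s i

0∷[]≋[] : 0ℚ ∷ [] ≋ []
0∷[]≋[] = mk≋ λ where
  zero    → refl
  (suc i) → refl

0+0≡0 : 0ℚ ℚ.+ 0ℚ ≡ 0ℚ
0+0≡0 = ℚ.+-identityˡ 0ℚ

scale-congʳ : ∀ a {p s} → p ≋ s → scale a p ≋ scale a s
scale-congʳ a {p} {s} (mk≋ p≈s) = mk≋ λ i →
  trans (coeff-scale a p i) (trans (cong (a ℚ.*_) (p≈s i)) (sym (coeff-scale a s i)))

scale-zeroˡ : ∀ p → scale 0ℚ p ≋ []
scale-zeroˡ p = mk≋ λ i → trans (coeff-scale 0ℚ p i) (ℚ.*-zeroˡ (coeff p i))

scale-identityˡ : ∀ p → scale 1ℚ p ≋ p
scale-identityˡ p = mk≋ λ i → trans (coeff-scale 1ℚ p i) (ℚ.*-identityˡ (coeff p i))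

scale-distrib-⊕ : ∀ a p s → scale a (p ⊕ s) ≋ scale a p ⊕ scale a s
scale-distrib-⊕ a p s = mk≋ λ i → begin
  coeff (scale a (p ⊕ s)) i                   ≡⟨ coeff-scale a (p ⊕ s) i ⟩
  a ℚ.* coeff (p ⊕ s) i                       ≡⟨ cong (a ℚ.*_) (coeff-⊕ p s i) ⟩
  a ℚ.* (coeff p i ℚ.+ coeff s i)             ≡⟨ ℚ.*-distribˡ-+ a (coeff p i) (coeff s i) ⟩
  a ℚ.* coeff p i ℚ.+ a ℚ.* coeff s i         ≡⟨ cong₂ ℚ._+_ (coeff-scale a p i) (coeff-scale a s i) ⟨
  coeff (scale a p) i ℚ.+ coeff (scale a s) i ≡⟨ coeff-⊕ (scale a p) (scale a s) i ⟨
  coeff (scale a p ⊕ scale a s) i             ∎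
  where open ≡-Reasoning

scale-distrib-+ : ∀ a b p → scale (a ℚ.+ b) p ≋ scale a p ⊕ scale b p
scale-distrib-+ a b p = mk≋ λ i → begin
  coeff (scale (a ℚ.+ b) p) i                 ≡⟨ coeff-scale (a ℚ.+ b) p i ⟩
  (a ℚ.+ b) ℚ.* coeff p i                     ≡⟨ ℚ.*-distribʳ-+ (coeff p i) a b ⟩
  a ℚ.* coeff p i ℚ.+ b ℚ.* coeff p i         ≡⟨ cong₂ ℚ._+_ (coeff-scale a p i) (coeff-scale b p i) ⟨
  coeff (scale a p) i ℚ.+ coeff (scale b p) i ≡⟨ coeff-⊕ (scale a p) (scale b p) i ⟨
  coeff (scale a p ⊕ scale b p) i             ∎
  where open ≡-Reasoning

scale-scale : ∀ a b p → scale a (scale b p) ≋ scale (a ℚ.* b) p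
scale-scale a b p = mk≋ λ i → begin
  coeff (scale a (scale b p)) i ≡⟨ coeff-scale a (scale b p) i ⟩
  a ℚ.* coeff (scale b p) i     ≡⟨ cong (a ℚ.*_) (coeff-scale b p i) ⟩
  a ℚ.* (b ℚ.* coeff p i)       ≡⟨ ℚ.*-assoc a b (coeff p i) ⟨
  a ℚ.* b ℚ.* coeff p i         ≡⟨ coeff-scale (a ℚ.* b) p i ⟨
  coeff (scale (a ℚ.* b) p) i   ∎
  where open ≡-Reasoning

0∷-⊛ : ∀ p s → (0ℚ ∷ p) ⊛ s ≋ 0ℚ ∷ p ⊛ s
0∷-⊛ p s = ⊕-congʳ (scale-zeroˡ s)

⊛-zeroʳ : ∀ p → p ⊛ [] ≋ []
⊛-zeroʳ []      = ≋-refl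
⊛-zeroʳ (a ∷ p) = ≋-trans (∷-cong refl (⊛-zeroʳ p)) 0∷[]≋[]

⊛-identityˡ : ∀ p → oneP ⊛ p ≋ p
⊛-identityˡ p = ≋-trans (⊕-cong (scale-identityˡ p) 0∷[]≋[]) (⊕-identityʳ p)

⊛-distribʳ : ∀ s p p′ → (p ⊕ p′) ⊛ s ≋ p ⊛ s ⊕ p′ ⊛ s
⊛-distribʳ s []      p′       = ≋-refl
⊛-distribʳ s (a ∷ p) []       = ≋-sym (⊕-identityʳ _)
⊛-distribʳ s (a ∷ p) (b ∷ p′) = ≋-trans
  (⊕-cong (scale-distrib-+ a b s) (∷-cong (sym 0+0≡0) (⊛-distribʳ s p p′)))
  (interchange (scale a s) (scale b s) (0ℚ ∷ p ⊛ s) (0ℚ ∷ p′ ⊛ s))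

scale-⊛ : ∀ a p s → scale a p ⊛ s ≋ scale a (p ⊛ s)
scale-⊛ a []      s = ≋-refl
scale-⊛ a (b ∷ p) s = ≋-trans
  (⊕-cong (≋-sym (scale-scale a b s)) (∷-cong (sym (ℚ.*-zeroʳ a)) (scale-⊛ a p s)))
  (≋-sym (scale-distrib-⊕ a (scale b s) (0ℚ ∷ p ⊛ s)))

⊛-assoc : ∀ p s t → (p ⊛ s) ⊛ t ≋ p ⊛ (s ⊛ t)
⊛-assoc []      s t = ≋-refl
⊛-assoc (a ∷ p) s t = ≋-trans (⊛-distribʳ t (scale a s) (0ℚ ∷ p ⊛ s))
  (⊕-cong (scale-⊛ a s t) (≋-trans (0∷-⊛ (p ⊛ s) t) (∷-cong refl (⊛-assoc p s t))))

⊛-∷ʳ : ∀ p b s → p ⊛ (b ∷ s) ≋ scale b p ⊕ (0ℚ ∷ p ⊛ s)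
⊛-∷ʳ []      b s = ≋-sym 0∷[]≋[]
⊛-∷ʳ (a ∷ p) b s = ∷-cong (cong (ℚ._+ 0ℚ) (ℚ.*-comm a b))
  (≋-trans (⊕-congˡ (⊛-∷ʳ p b s)) (x∙yz≈y∙xz (scale a s) (scale b p) (0ℚ ∷ p ⊛ s)))

⊛-comm : ∀ p s → p ⊛ s ≋ s ⊛ p
⊛-comm []      s = ≋-sym (⊛-zeroʳ s)
⊛-comm (a ∷ p) s = ≋-trans (⊕-congˡ (∷-cong refl (⊛-comm p s))) (≋-sym (⊛-∷ʳ s a p))

≋[]⇒⊛≋[] : ∀ {p} s → p ≋ [] → p ⊛ s ≋ []
≋[]⇒⊛≋[] {[]}    s _       = ≋-refl
≋[]⇒⊛≋[] {a ∷ p} s (mk≋ e) = ≋-trans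
  (⊕-cong (≋-trans (≋-reflexive (cong (λ a → scale a s) (e 0))) (scale-zeroˡ s))
          (∷-cong refl (≋[]⇒⊛≋[] s p≋[])))
  0∷[]≋[]
  where
  p≋[] : p ≋ []
  p≋[] = mk≋ (e ∘ suc)

⊛-congˡ : ∀ {p p′} s → p ≋ p′ → p ⊛ s ≋ p′ ⊛ s
⊛-congˡ {[]}    {p′}     s p≋p′    = ≋-sym (≋[]⇒⊛≋[] s (≋-sym p≋p′))
⊛-congˡ {a ∷ p} {[]}     s p≋p′    = ≋[]⇒⊛≋[] s p≋p′
⊛-congˡ {a ∷ p} {b ∷ p′} s (mk≋ e) =
  ⊕-cong (≋-reflexive (cong (λ x → scale x s) (e 0))) (∷-cong refl (⊛-congˡ s p≋p′))
  where
  p≋p′ : p ≋ p′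
  p≋p′ = mk≋ (e ∘ suc)

⊛-cong : ∀ {p p′ s s′} → p ≋ p′ → s ≋ s′ → p ⊛ s ≋ p′ ⊛ s′
⊛-cong {p} {p′} {s} {s′} p≋p′ s≋s′ = begin
  p ⊛ s   ≈⟨ ⊛-congˡ s p≋p′ ⟩
  p′ ⊛ s  ≈⟨ ⊛-comm p′ s ⟩
  s ⊛ p′  ≈⟨ ⊛-congˡ p′ s≋s′ ⟩
  s′ ⊛ p′ ≈⟨ ⊛-comm s′ p′ ⟩
  p′ ⊛ s′ ∎
  where open ≈-Reasoning setoid

polyCommutativeRing : CommutativeRing 0ℓ 0ℓ
polyCommutativeRing = record
  { _≈_ = _≋_ ; _+_ = _⊕_ ; _*_ = _⊛_ ; -_ = neg ; 0# = zeroP ; 1# = oneP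
  ; isCommutativeRing = record
    { isRing = record
      { +-isAbelianGroup = AbelianGroup.isAbelianGroup ⊕-abelianGroup
      ; *-cong           = ⊛-cong
      ; *-assoc          = ⊛-assoc
      ; *-identity       = comm∧idˡ⇒id ⊛-comm ⊛-identityˡ
      ; distrib          = comm∧distrʳ⇒distr ⊕-cong ⊛-comm ⊛-distribʳ
      }
    ; *-comm = ⊛-comm
    }
  }
  where open import Algebra.Consequences.Setoid setoid using (comm∧idˡ⇒id; comm∧distrʳ⇒distr)

open CommutativeRingDivisibility polyCommutativeRing
private
  module P = CommutativeRing polyCommutativeRing

  -- Without a zero test the solver cannot cancel terms, so it proves only identities in
  -- which no cancellation occurs.
  polyACR : AlmostCommutativeRing 0ℓ 0ℓ
  polyACR = fromCommutativeRing polyCommutativeRing (λ _ → nothing)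

neg[1-x]≋x-1 : ∀ x → neg (oneP ⊖ x) ≋ x ⊖ oneP
neg[1-x]≋x-1 = solve-∀ polyACR

X : Poly
X = qPow 1

0∷≋X⊛ : ∀ p → 0ℚ ∷ p ≋ X ⊛ p
0∷≋X⊛ p = ≋-sym (≋-trans (0∷-⊛ oneP p) (∷-cong refl (⊛-identityˡ p)))

qPow≋X^ : ∀ n → qPow n ≋ X ^ n
qPow≋X^ zero    = ≋-refl
qPow≋X^ (suc n) = ≋-trans (0∷≋X⊛ (qPow n)) (P.*-congˡ {X} (qPow≋X^ n))

1-cong : ∀ {p s} → p ≋ s → oneP ⊖ p ≋ oneP ⊖ s
1-cong p≋s = P.+-congˡ (P.-‿cong p≋s)

1-qPow∣1-qPow[j*n] : ∀ n j → oneP ⊖ qPow n ∣ oneP ⊖ qPow (j * n)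
1-qPow∣1-qPow[j*n] n j =
  ∣ʳ-respˡ-≈ (1-cong (≋-sym (qPow≋X^ n))) (∣ʳ-respʳ-≈ (1-cong X^n^j≋qPow[j*n]) (1-x∣1-x^n (X ^ n) j))
  where
  X^n^j≋qPow[j*n] : (X ^ n) ^ j ≋ qPow (j * n)
  X^n^j≋qPow[j*n] = ≋-trans (^-assocʳ X n j)
    (≋-trans (≋-reflexive (cong (X ^_) (ℕ.*-comm n j))) (≋-sym (qPow≋X^ (j * n))))

1-qPow∣numer : ∀ n e → + n ∣ℤ e → oneP ⊖ qPow n ∣ numer e
1-qPow∣numer n (+ a)    (divides j refl)    = 1-qPow∣1-qPow[j*n] n j
1-qPow∣numer n -[1+ a ] (divides j 1+a≡j*n) = ∣ʳ-respʳ-≈ (neg[1-x]≋x-1 (qPow (suc a)))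
  (∣-‿ (∣ʳ-respʳ-≈ (≋-reflexive (cong (λ b → oneP ⊖ qPow b) (sym 1+a≡j*n))) (1-qPow∣1-qPow[j*n] n j)))

comaximal-qPow : ∀ {c} n a → c ∣ oneP ⊖ qPow (suc n) → Comaximal c (qPow a)
comaximal-qPow {c} n a c∣1-qⁿ = comaximal-respʳ (≋-sym (qPow≋X^ a))
  (comaximal-^ʳ (x∣1-yz⇒comaximal {y = X} {z = X ^ n} c∣1-X·Xⁿ) a)
  where
  c∣1-X·Xⁿ : c ∣ oneP ⊖ X ⊛ X ^ n
  c∣1-X·Xⁿ = ∣ʳ-respʳ-≈ (1-cong (qPow≋X^ (suc n))) c∣1-qⁿ

comaximal-denom : ∀ {c} n e → c ∣ oneP ⊖ qPow (suc n) → Comaximal c (denom e)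
comaximal-denom n (+ a)    = comaximal-qPow n 0
comaximal-denom n -[1+ a ] = comaximal-qPow n (suc a)

record DegreeBelow (n : ℕ) (p : Poly) : Set where
  constructor mkDeg<
  field vanishes : ∀ i → n ≤ i → coeff p i ≡ 0ℚ

degreeBelow-length : ∀ p → DegreeBelow (length p) p
degreeBelow-length p = mkDeg< (vanish p)
  where
  vanish : ∀ p i → length p ≤ i → coeff p i ≡ 0ℚ
  vanish []      i       _           = refl
  vanish (a ∷ p) (suc i) (ℕ.s≤s n≤i) = vanish p i n≤i

degreeBelow-mono : ∀ {m n p} → m ≤ n → DegreeBelow m p → DegreeBelow n p
degreeBelow-mono m≤n (mkDeg< p↓) = mkDeg< λ i n≤i → p↓ i (ℕ.≤-trans m≤n n≤i)

degreeBelow-pred : ∀ {n p} → DegreeBelow (suc n) p → coeff p n ≡ 0ℚ → DegreeBelow n p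
degreeBelow-pred {n} {p} (mkDeg< p↓) pₙ≡0 = mkDeg< vanish
  where
  vanish : ∀ i → n ≤ i → coeff p i ≡ 0ℚ
  vanish i n≤i with ℕ.m≤n⇒m<n∨m≡n n≤i
  ... | inj₁ n<i  = p↓ i n<i
  ... | inj₂ refl = pₙ≡0

degreeBelow-zero : ∀ {p} → DegreeBelow 0 p → p ≋ []
degreeBelow-zero (mkDeg< p↓) = mk≋ λ i → p↓ i ℕ.z≤n

degreeBelow-resp : ∀ {n p s} → p ≋ s → DegreeBelow n p → DegreeBelow n s
degreeBelow-resp (mk≋ p≈s) (mkDeg< p↓) = mkDeg< λ i n≤i → trans (sym (p≈s i)) (p↓ i n≤i)

degreeBelow-∷ : ∀ {n a p} → DegreeBelow n p → DegreeBelow (suc n) (a ∷ p)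
degreeBelow-∷ (mkDeg< p↓) = mkDeg< λ where
  (suc i) (ℕ.s≤s n≤i) → p↓ i n≤i

degreeBelow-⊖ : ∀ {n p s} → DegreeBelow n p → DegreeBelow n s → DegreeBelow n (p ⊖ s)
degreeBelow-⊖ {p = p} {s} (mkDeg< p↓) (mkDeg< s↓) = mkDeg< λ i n≤i → begin
  coeff (p ⊖ s) i               ≡⟨ coeff-⊕ p (neg s) i ⟩
  coeff p i ℚ.+ coeff (neg s) i ≡⟨ cong (coeff p i ℚ.+_) (coeff-neg s i) ⟩
  coeff p i ℚ.+ ℚ.- coeff s i   ≡⟨ cong₂ (λ x y → x ℚ.+ ℚ.- y) (p↓ i n≤i) (s↓ i n≤i) ⟩
  0ℚ ℚ.+ ℚ.- 0ℚ                 ≡⟨⟩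
  0ℚ                            ∎
  where open ≡-Reasoning

degreeBelow-scale : ∀ {n p} a → DegreeBelow n p → DegreeBelow n (scale a p)
degreeBelow-scale {p = p} a (mkDeg< p↓) = mkDeg< λ i n≤i →
  trans (coeff-scale a p i) (trans (cong (a ℚ.*_) (p↓ i n≤i)) (ℚ.*-zeroʳ a))

degreeBelow-qPow⊛ : ∀ {n b} k → DegreeBelow n b → DegreeBelow (k ℕ.+ n) (qPow k ⊛ b)
degreeBelow-qPow⊛ {b = b} zero    b↓ = degreeBelow-resp (≋-sym (⊛-identityˡ b)) b↓
degreeBelow-qPow⊛ {b = b} (suc k) b↓ =
  degreeBelow-resp (≋-sym (0∷-⊛ (qPow k) b)) (degreeBelow-∷ (degreeBelow-qPow⊛ k b↓))

coeff-qPow⊛ : ∀ k b i → coeff (qPow k ⊛ b) (k ℕ.+ i) ≡ coeff b i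
coeff-qPow⊛ zero    b i = coeff-≡ (⊛-identityˡ b) i
coeff-qPow⊛ (suc k) b i = trans (coeff-≡ (0∷-⊛ (qPow k) b) (suc (k ℕ.+ i))) (coeff-qPow⊛ k b i)

÷-*-cancel : ∀ x y .{{_ : ℚ.NonZero y}} → x ℚ.÷ y ℚ.* y ≡ x
÷-*-cancel x y = trans (ℚ.*-assoc x (ℚ.1/ y) y) (trans (cong (x ℚ.*_) (ℚ.*-inverseˡ y)) (ℚ.*-identityʳ x))

leading-term : ∀ k {n} a b → coeff b n ≢ 0ℚ → DegreeBelow (suc n) b → DegreeBelow (suc k ℕ.+ n) a →
               ∃ λ m → DegreeBelow (k ℕ.+ n) (a ⊖ m ⊛ b)
leading-term k {n} a b bₙ≢0 b↓ a↓ = m , a-mb↓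
  where
  instance _ = ℚ.≢-nonZero bₙ≢0
  top = k ℕ.+ n
  aₜ = coeff a top
  κ = aₜ ℚ.÷ coeff b n
  m = scale κ (qPow k)

  m⊛b≋ : m ⊛ b ≋ scale κ (qPow k ⊛ b)
  m⊛b≋ = scale-⊛ κ (qPow k) b

  m⊛b-top : coeff (m ⊛ b) top ≡ aₜ
  m⊛b-top = begin
    coeff (m ⊛ b) top                ≡⟨ coeff-≡ m⊛b≋ top ⟩
    coeff (scale κ (qPow k ⊛ b)) top ≡⟨ coeff-scale κ (qPow k ⊛ b) top ⟩
    κ ℚ.* coeff (qPow k ⊛ b) top     ≡⟨ cong (κ ℚ.*_) (coeff-qPow⊛ k b n) ⟩
    κ ℚ.* coeff b n                  ≡⟨ ÷-*-cancel aₜ (coeff b n) ⟩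
    aₜ                               ∎
    where open ≡-Reasoning

  a-mb-top : coeff (a ⊖ m ⊛ b) top ≡ 0ℚ
  a-mb-top = begin
    coeff (a ⊖ m ⊛ b) top          ≡⟨ coeff-⊕ a (neg (m ⊛ b)) top ⟩
    aₜ ℚ.+ coeff (neg (m ⊛ b)) top ≡⟨ cong (aₜ ℚ.+_) (coeff-neg (m ⊛ b) top) ⟩
    aₜ ℚ.+ ℚ.- coeff (m ⊛ b) top   ≡⟨ cong (λ x → aₜ ℚ.+ ℚ.- x) m⊛b-top ⟩
    aₜ ℚ.+ ℚ.- aₜ                  ≡⟨ ℚ.+-inverseʳ aₜ ⟩
    0ℚ                             ∎
    where open ≡-Reasoning

  m⊛b↓ : DegreeBelow (suc top) (m ⊛ b)
  m⊛b↓ = degreeBelow-resp (≋-sym m⊛b≋)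
    (degreeBelow-scale κ (subst (λ j → DegreeBelow j (qPow k ⊛ b)) (ℕ.+-suc k n) (degreeBelow-qPow⊛ k b↓)))

  a-mb↓ : DegreeBelow top (a ⊖ m ⊛ b)
  a-mb↓ = degreeBelow-pred (degreeBelow-⊖ a↓ m⊛b↓) a-mb-top

Division : Poly → Poly → ℕ → Set
Division a b n = ∃₂ λ quot rem → DegreeBelow n rem × a ≋ quot ⊛ b ⊕ rem

divide : ∀ k {n} a b → coeff b n ≢ 0ℚ → DegreeBelow (suc n) b → DegreeBelow (k ℕ.+ n) a → Division a b n
divide zero    a b _ _ a↓ = [] , a , a↓ , ≋-refl
divide (suc k) a b bₙ≢0 b↓ a↓
  with m , a-mb↓ ← leading-term k a b bₙ≢0 b↓ a↓
  with quot , rem , rem↓ , a-mb≋ ← divide k (a ⊖ m ⊛ b) b bₙ≢0 b↓ a-mb↓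
  = quot ⊕ m , rem , rem↓ , add-back a m b quot rem a-mb≋
  where
  add-back : ∀ a m b q r → a ⊖ m ⊛ b ≋ q ⊛ b ⊕ r → a ≋ (q ⊕ m) ⊛ b ⊕ r
  add-back a m b q r a-mb≋ = begin
    a                   ≈⟨ //-rightDividesˡ (m ⊛ b) a ⟨
    (a ⊖ m ⊛ b) ⊕ m ⊛ b ≈⟨ ⊕-congʳ a-mb≋ ⟩
    (q ⊛ b ⊕ r) ⊕ m ⊛ b ≈⟨ regroup q b r m ⟩
    (q ⊕ m) ⊛ b ⊕ r     ∎
    where
    open ≈-Reasoning setoid
    open import Algebra.Properties.Group P.+-group using (//-rightDividesˡ)
    regroup : ∀ q b r m → (q ⊛ b ⊕ r) ⊕ m ⊛ b ≋ (q ⊕ m) ⊛ b ⊕ r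
    regroup = solve-∀ polyACR

bézout : ∀ a b → Bézout a b
bézout a b = bézout-below (length b) a b (degreeBelow-length b)
  where
  bézout-below : ∀ n a b → DegreeBelow n b → Bézout a b
  bézout-below zero    a b b↓ = bézout-zero (degreeBelow-zero b↓)
  bézout-below (suc n) a b b↓ with coeff b n ℚ.≟ 0ℚ
  ... | yes bₙ≡0 = bézout-below n a b (degreeBelow-pred b↓ bₙ≡0)
  ... | no  bₙ≢0
    with quot , rem , rem↓ , a≋ ← divide (length a) a b bₙ≢0 b↓
                                    (degreeBelow-mono (ℕ.m≤m+n (length a) n) (degreeBelow-length a))
    = bézout-step {q = quot} a≋ (bézout-below n b rem rem↓)

-- (a + q·p)′ = p + q·p′
deriv : Poly → Poly
deriv []      = []
deriv (a ∷ p) = p ⊕ (0ℚ ∷ deriv p)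

≋[]⇒deriv≋[] : ∀ {p} → p ≋ [] → deriv p ≋ []
≋[]⇒deriv≋[] {[]}    _       = ≋-refl
≋[]⇒deriv≋[] {a ∷ p} (mk≋ e) = ≋-trans (⊕-cong p≋[] (∷-cong refl (≋[]⇒deriv≋[] p≋[]))) 0∷[]≋[]
  where
  p≋[] : p ≋ []
  p≋[] = mk≋ (e ∘ suc)

deriv-cong : ∀ {p s} → p ≋ s → deriv p ≋ deriv s
deriv-cong {[]}    {s}     p≋s     = ≋-sym (≋[]⇒deriv≋[] (≋-sym p≋s))
deriv-cong {a ∷ p} {[]}    p≋s     = ≋[]⇒deriv≋[] p≋s
deriv-cong {a ∷ p} {b ∷ s} (mk≋ e) = ⊕-cong p≋s (∷-cong refl (deriv-cong p≋s))
  where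
  p≋s : p ≋ s
  p≋s = mk≋ (e ∘ suc)

deriv-⊕ : ∀ p s → deriv (p ⊕ s) ≋ deriv p ⊕ deriv s
deriv-⊕ []      s       = ≋-refl
deriv-⊕ (a ∷ p) []      = ≋-sym (⊕-identityʳ _)
deriv-⊕ (a ∷ p) (b ∷ s) = ≋-trans
  (⊕-congˡ (∷-cong (sym 0+0≡0) (deriv-⊕ p s)))
  (interchange p s (0ℚ ∷ deriv p) (0ℚ ∷ deriv s))

deriv-scale : ∀ a p → deriv (scale a p) ≋ scale a (deriv p)
deriv-scale a []      = ≋-refl
deriv-scale a (b ∷ p) = ≋-trans
  (⊕-congˡ (∷-cong (sym (ℚ.*-zeroʳ a)) (deriv-scale a p)))
  (≋-sym (scale-distrib-⊕ a p (0ℚ ∷ deriv p)))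

deriv-⊛ : ∀ p s → deriv (p ⊛ s) ≋ deriv p ⊛ s ⊕ p ⊛ deriv s
deriv-⊛ []      s = ≋-refl
deriv-⊛ (a ∷ p) s = begin
  deriv (scale a s ⊕ (0ℚ ∷ p ⊛ s))
    ≈⟨ deriv-⊕ (scale a s) (0ℚ ∷ p ⊛ s) ⟩
  deriv (scale a s) ⊕ (p ⊛ s ⊕ (0ℚ ∷ deriv (p ⊛ s)))
    ≈⟨ ⊕-cong (deriv-scale a s) (⊕-congˡ {p ⊛ s} (≋-trans (0∷≋X⊛ _) (P.*-congˡ {X} (deriv-⊛ p s)))) ⟩
  scale a (deriv s) ⊕ (p ⊛ s ⊕ X ⊛ (deriv p ⊛ s ⊕ p ⊛ deriv s))
    ≈⟨ regroup (scale a (deriv s)) p s (deriv p) (deriv s) ⟩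
  (p ⊕ X ⊛ deriv p) ⊛ s ⊕ (scale a (deriv s) ⊕ X ⊛ (p ⊛ deriv s))
    ≈⟨ ⊕-cong (⊛-congˡ s (⊕-congˡ {p} (≋-sym (0∷≋X⊛ _))))
              (⊕-congˡ {scale a (deriv s)} (≋-sym (0∷≋X⊛ _))) ⟩
  (p ⊕ (0ℚ ∷ deriv p)) ⊛ s ⊕ (scale a (deriv s) ⊕ (0ℚ ∷ p ⊛ deriv s))
    ∎
  where
  open ≈-Reasoning setoid
  regroup : ∀ c p s p′ s′ →
    c ⊕ (p ⊛ s ⊕ X ⊛ (p′ ⊛ s ⊕ p ⊛ s′)) ≋ (p ⊕ X ⊛ p′) ⊛ s ⊕ (c ⊕ X ⊛ (p ⊛ s′))
  regroup = solve-∀ polyACR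

∣-deriv : ∀ {c p} → c ⊛ c ∣ p → c ∣ deriv p
∣-deriv {c} {p} (t , t⊛c²≋p) = deriv t ⊛ c ⊕ (t ⊛ deriv c ⊕ t ⊛ deriv c) , (begin
  (deriv t ⊛ c ⊕ (t ⊛ deriv c ⊕ t ⊛ deriv c)) ⊛ c     ≈⟨ regroup (deriv t) t c (deriv c) ⟩
  deriv t ⊛ (c ⊛ c) ⊕ t ⊛ (deriv c ⊛ c ⊕ c ⊛ deriv c) ≈⟨ ⊕-congˡ {deriv t ⊛ (c ⊛ c)} (P.*-congˡ {t} c²′≋) ⟨
  deriv t ⊛ (c ⊛ c) ⊕ t ⊛ deriv (c ⊛ c)               ≈⟨ deriv-⊛ t (c ⊛ c) ⟨
  deriv (t ⊛ (c ⊛ c))                                 ≈⟨ deriv-cong t⊛c²≋p ⟩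
  deriv p                                             ∎)
  where
  open ≈-Reasoning setoid
  c²′≋ : deriv (c ⊛ c) ≋ deriv c ⊛ c ⊕ c ⊛ deriv c
  c²′≋ = deriv-⊛ c c
  regroup : ∀ t′ t c c′ →
    (t′ ⊛ c ⊕ (t ⊛ c′ ⊕ t ⊛ c′)) ⊛ c ≋ t′ ⊛ (c ⊛ c) ⊕ t ⊛ (c′ ⊛ c ⊕ c ⊛ c′)
  regroup = solve-∀ polyACR

-- 1 + (1 + ⋯ + 0), the form in which deriv produces the exponent of qPow as a coefficient.
fromℕ : ℕ → ℚ
fromℕ zero    = 0ℚ
fromℕ (suc n) = 1ℚ ℚ.+ fromℕ n

fromℕ-nonNeg : ∀ n → ℚ.NonNegative (fromℕ n)
fromℕ-nonNeg zero    = _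
fromℕ-nonNeg (suc n) = ℚ.nonNeg+nonNeg⇒nonNeg 1ℚ (fromℕ n) {{fromℕ-nonNeg n}}

fromℕ-suc-nonZero : ∀ n → ℚ.NonZero (fromℕ (suc n))
fromℕ-suc-nonZero n =
  ℚ.pos⇒nonZero (fromℕ (suc n)) {{ℚ.pos+nonNeg⇒pos 1ℚ (fromℕ n) {{fromℕ-nonNeg n}}}}

deriv-qPow : ∀ h → deriv (qPow (suc h)) ≋ scale (fromℕ (suc h)) (qPow h)
deriv-qPow zero    = ∷-cong refl 0∷[]≋[]
deriv-qPow (suc h) = begin
  qPow (suc h) ⊕ (0ℚ ∷ deriv (qPow (suc h)))
    ≈⟨ ⊕-cong (≋-sym (scale-identityˡ (qPow (suc h)))) (∷-cong (sym (ℚ.*-zeroʳ N)) (deriv-qPow h)) ⟩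
  scale 1ℚ (qPow (suc h)) ⊕ scale N (qPow (suc h))
    ≈⟨ scale-distrib-+ 1ℚ N (qPow (suc h)) ⟨
  scale (1ℚ ℚ.+ N) (qPow (suc h))
    ∎
  where
  open ≈-Reasoning setoid
  N = fromℕ (suc h)

∣-scale : ∀ {c p} a → c ∣ p → c ∣ scale a p
∣-scale {c} a (t , t⊛c≋p) = scale a t , ≋-trans (scale-⊛ a t c) (scale-congʳ a t⊛c≋p)

c²∣1-qPow⇒c∣qPow : ∀ {c} h → c ⊛ c ∣ oneP ⊖ qPow (suc h) → c ∣ qPow h
c²∣1-qPow⇒c∣qPow {c} h c²∣1-qᴺ = ∣ʳ-respʳ-≈ unscale (∣-scale (ℚ.1/ N) c∣Nqʰ)
  where
  N = fromℕ (suc h)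
  instance _ = fromℕ-suc-nonZero h
  deriv[qᴺ-1]≋Nqʰ : deriv (qPow (suc h) ⊖ oneP) ≋ scale N (qPow h)
  deriv[qᴺ-1]≋Nqʰ = ≋-trans (deriv-⊕ (qPow (suc h)) (neg oneP))
    (≋-trans (⊕-congˡ {deriv (qPow (suc h))} 0∷[]≋[]) (≋-trans (⊕-identityʳ _) (deriv-qPow h)))
  c∣Nqʰ : c ∣ scale N (qPow h)
  c∣Nqʰ = ∣ʳ-respʳ-≈ deriv[qᴺ-1]≋Nqʰ
    (∣-deriv (∣ʳ-respʳ-≈ (neg[1-x]≋x-1 (qPow (suc h))) (∣-‿ c²∣1-qᴺ)))
  unscale : scale (ℚ.1/ N) (scale N (qPow h)) ≋ qPow h
  unscale = ≋-trans (scale-scale (ℚ.1/ N) N (qPow h))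
    (≋-trans (≋-reflexive (cong (λ a → scale a (qPow h)) (ℚ.*-inverseˡ N)))
             (scale-identityˡ (qPow h)))

relPrime⇒coprime : ∀ {a b} → RelPrime a b → Coprime a b
relPrime⇒coprime a⊥b g (s , s⊛g≋a) (t , t⊛g≋b)
  with u , u⊛g≈1 ← a⊥b g (s , coeff-≡ s⊛g≋a) (t , coeff-≡ t⊛g≋b) = u , mk≋ u⊛g≈1

coprime⇒relPrime : ∀ {a b} → Coprime a b → RelPrime a b
coprime⇒relPrime a⊥b g (s , s⊛g≈a) (t , t⊛g≈b)
  with u , u⊛g≋1 ← a⊥b g (s , mk≋ s⊛g≈a) (t , mk≋ t⊛g≈b) = u , coeff-≡ u⊛g≋1

denominator-coprime : ∀ n h e {A B} → + suc n ∣ℤ e → RelPrime A B →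
  A ⊛ denom e ⊛ (oneP ⊖ qPow (suc h)) ≋ B ⊛ numer e → RelPrime B (oneP ⊖ qPow (suc n))
denominator-coprime n h e {A} {B} n∣e A⊥B ADQ≋BN = coprime⇒relPrime coprime
  where
  coprime : Coprime B (oneP ⊖ qPow (suc n))
  coprime c c∣B c∣1-qⁿ = comaximal∧x∣y⇒x∣1 (comaximal-qPow n h c∣1-qⁿ) (c²∣1-qPow⇒c∣qPow h c²∣Q)
    where
    c⊥A : Comaximal c A
    c⊥A = bézout∧coprime⇒comaximal (bézout c A)
      (λ g g∣c g∣A → relPrime⇒coprime A⊥B g g∣A (∣ʳ-trans g∣c c∣B))
    c⊥AD : Comaximal c (A ⊛ denom e)
    c⊥AD = comaximal-*ʳ c⊥A (comaximal-denom n e c∣1-qⁿ)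
    c²∣ADQ : c ⊛ c ∣ A ⊛ denom e ⊛ (oneP ⊖ qPow (suc h))
    c²∣ADQ = ∣ʳ-respʳ-≈ (≋-sym ADQ≋BN) (∙-cong-∣ c∣B (∣ʳ-trans c∣1-qⁿ (1-qPow∣numer (suc n) e n∣e)))
    c²∣Q : c ⊛ c ∣ oneP ⊖ qPow (suc h)
    c²∣Q = comaximal∧x∣yz⇒x∣z (comaximal-*ˡ c⊥AD c⊥AD) c²∣ADQ

lemma2p6 : (n d : ℕ) → 1 ≤ n → 1 ≤ d → gcd n d ≡ 1 →
    (r : ℤ) → gcd ∣ r ∣ d ≡ 1 →
    (m : ℕ) → m < n → (+ n) ∣ℤ (+ (m * d) +ℤ r) →
    (k : ℕ) → 1 ≤ k → k ≤ m →
    (A B : Poly) → RelPrime A B → RepQuot (+ (m * d) +ℤ r) (d * k) A B →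
    RelPrime B (oneP ⊖ qPow n)
lemma2p6 (suc n) (suc d) _ _ _ r _ m _ n∣e (suc k) _ _ A B A⊥B (_ , ADQ≈BN) =
  denominator-coprime n (k ℕ.+ d * suc k) (+ (m * suc d) +ℤ r) {A} {B} n∣e A⊥B (mk≋ ADQ≈BN)
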